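{- Let $d,k,s$ be natural numbers and let $C(\vec x)$ be the condition that $x_i\ge 0$ for all $i\in\{0,\ldots,k\}$. Then the set $A_{d,s,k}\cup A_{d,s+1,k,C}$ is 3-free.
   Context: For natural numbers $d,s,k$, $A_{d,s,k}$ is the set of integers $x$ that can be written as $x=\sum_{i=0}^{k-1} x_i (4d+1)^i$ with integers $-d\le x_i\le d$ and $\sum_{i=0}^{k-1}x_i^2=s$. For a condition $C$ on vectors $\vec x=(x_0,\ldots,x_k)$, $A_{d,s,k,C}$ is the set of integers $x$ that can be written as $x=\sum_{i=0}^{k} x_i (4d+1)^i$ with integers $-d\le x_i\le d$, $\sum_{i=0}^{k}x_i^2=s$, and $C(x_0,\ldots,x_k)$ true. A set of integers is 3-free if it contains no three elements $x<y<z$ with $x+z=2y$. -}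

module Defs where

open import Data.Nat using (ℕ; suc)
open import Data.Fin using (Fin; toℕ)
open import Data.Integer using (ℤ; +_; -_; _+_; _*_; _≤_; _<_; _^_)
open import Data.Product using (Σ; _×_; _,_)
open import Data.Sum using (_⊎_)
open import Relation.Binary.PropositionalEquality using (_≡_)
open import Relation.Nullary using (¬_)

sumFin : (n : ℕ) → (Fin n → ℤ) → ℤ
sumFin ℕ.zero f = + 0
sumFin (suc n) f = f Fin.zero + sumFin n (λ i → f (Fin.suc i))

base : ℕ → ℤ
base d = + (4 Data.Nat.* d Data.Nat.+ 1)

value : (d n : ℕ) → (Fin n → ℤ) → ℤ
value d n x = sumFin n (λ i → x i * (base d ^ toℕ i))

sqSum : (n : ℕ) → (Fin n → ℤ) → ℤ
sqSum n x = sumFin n (λ i → x i * x i)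

Digits : (d n : ℕ) → (Fin n → ℤ) → Set
Digits d n x = (i : Fin n) → (- (+ d) ≤ x i) × (x i ≤ + d)

A : (d s k : ℕ) → ℤ → Set
A d s k x = Σ (Fin k → ℤ) λ v →
  Digits d k v × (sqSum k v ≡ + s) × (value d k v ≡ x)

-- A_{d,s,k,C}: digits x_0..x_k (k+1 digits) satisfying C
AC : (d s k : ℕ) → ((Fin (suc k) → ℤ) → Set) → ℤ → Set
AC d s k C x = Σ (Fin (suc k) → ℤ) λ v →
  Digits d (suc k) v × (sqSum (suc k) v ≡ + s) × C v × (value d (suc k) v ≡ x)

Nonneg : (n : ℕ) → (Fin n → ℤ) → Set
Nonneg n v = (i : Fin n) → + 0 ≤ v i

ThreeFree : (ℤ → Set) → Set
ThreeFree S = (x y z : ℤ) → S x → S y → S z → x < y → y < z → ¬ (x + z ≡ + 2 * y)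

_∪_ : (ℤ → Set) → (ℤ → Set) → ℤ → Set
(S ∪ T) x = S x ⊎ T x

module Submission where

-- Pad the elements of A_{d,s,k} with a zero top digit. Then every element of the union is the value
-- of a digit vector of length k+1 with digits in [-d, d] and squared norm s + e, e ∈ {0, 1}, whose
-- digits are nonnegative when e = 1. If x + z = 2y with digit vectors u, w, v, the vector
-- u + w - 2v has digits in [-4d, 4d] and value 0 in base 4d+1, so u + w = 2v digitwise. The
-- parallelogram law |u|² + |w|² = 2|v|² + 2|u - v|² then leaves two cases: u = v, so x = y; or
-- |u - v|² = 1 and u, w are nonnegative of equal norm. In the latter case u - v = ±e_j, and
-- |u|² - |w|² = 4 v·(u - v) = 0 gives v_j = 0. Then u_j = -w_j with u_j, w_j ≥ 0, so u_j = 0 = v_j,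
-- contradicting (u - v)_j ≠ 0.

open import Algebra.Bundles using (AbelianGroup)
open import Data.Empty using (⊥; ⊥-elim)
open import Data.Fin using (Fin; zero; suc; toℕ)
open import Data.Integer as ℤ using (ℤ; +_; -[1+_]; -_; _+_; _*_; _-_; ∣_∣; _^_; +≤+; -≤-; 0ℤ)
import Data.Integer.Properties as ℤ
open import Data.Integer.Tactic.RingSolver using (solve)
open import Data.List using ([]; _∷_)
import Data.Nat as ℕ
open import Data.Nat using (ℕ; zero; suc; z≤n; s≤s)
import Data.Nat.Properties as ℕ
import Data.Nat.Tactic.RingSolver as ℕ-Solver
open import Data.Product using (Σ-syntax; _×_; _,_)
open import Data.Sum using (_⊎_; inj₁; inj₂; [_,_]′; reduce)
open import Function using (_∘_; id)
open import Relation.Binary.PropositionalEquality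

open import Algebra.Properties.CommutativeSemigroup ℤ.*-commutativeSemigroup using (x∙yz≈y∙xz)
open import Algebra.Properties.Group (AbelianGroup.group ℤ.+-0-abelianGroup) using (∙-cancelˡ)
open import Algebra.Properties.Semiring.Sum ℤ.+-*-semiring
  using (sum; sum-cong-≗; ∑-distrib-+; *-distribˡ-sum; sum-replicate-zero)

open import Defs

sumFin≡sum : ∀ n (f : Fin n → ℤ) → sumFin n f ≡ sum f
sumFin≡sum zero    f = refl
sumFin≡sum (suc n) f = cong (_+_ (f zero)) (sumFin≡sum n (f ∘ suc))

sumFin-cong : ∀ n {f g : Fin n → ℤ} → (∀ i → f i ≡ g i) → sumFin n f ≡ sumFin n g
sumFin-cong n {f} {g} f≗g rewrite sumFin≡sum n f | sumFin≡sum n g = sum-cong-≗ f≗g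

sumFin-+ : ∀ n (f g : Fin n → ℤ) → sumFin n (λ i → f i + g i) ≡ sumFin n f + sumFin n g
sumFin-+ n f g
  rewrite sumFin≡sum n (λ i → f i + g i) | sumFin≡sum n f | sumFin≡sum n g = ∑-distrib-+ f g

*-distribˡ-sumFin : ∀ n c (f : Fin n → ℤ) → c * sumFin n f ≡ sumFin n (λ i → c * f i)
*-distribˡ-sumFin n c f
  rewrite sumFin≡sum n f | sumFin≡sum n (λ i → c * f i) = *-distribˡ-sum c f

sumFin-zero : ∀ n → sumFin n (λ _ → 0ℤ) ≡ 0ℤ
sumFin-zero n = trans (sumFin≡sum n _) (sum-replicate-zero n)

dot : (n : ℕ) → (Fin n → ℤ) → (Fin n → ℤ) → ℤ
dot n g x = sumFin n (λ i → g i * x i)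

dot-zeroʳ : ∀ n (g x : Fin n → ℤ) → (∀ i → x i ≡ 0ℤ) → dot n g x ≡ 0ℤ
dot-zeroʳ n g x x≗0 =
  trans (sumFin-cong n (λ i → trans (cong (g i *_) (x≗0 i)) (ℤ.*-zeroʳ (g i)))) (sumFin-zero n)

value-suc : ∀ d n (x : Fin (suc n) → ℤ) → value d (suc n) x ≡ x zero + base d * value d n (x ∘ suc)
value-suc d n x = cong₂ _+_ (ℤ.*-identityʳ (x zero)) (begin
  sumFin n (λ i → x (suc i) * (base d * base d ^ toℕ i))
    ≡⟨ sumFin-cong n (λ i → x∙yz≈y∙xz (x (suc i)) (base d) _) ⟩
  sumFin n (λ i → base d * (x (suc i) * base d ^ toℕ i))
    ≡⟨ *-distribˡ-sumFin n (base d) _ ⟨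
  base d * value d n (x ∘ suc)
    ∎)
  where open ≡-Reasoning

value-+ : ∀ d n (x y : Fin n → ℤ) → value d n (λ i → x i + y i) ≡ value d n x + value d n y
value-+ d n x y =
  trans (sumFin-cong n (λ i → ℤ.*-distribʳ-+ (base d ^ toℕ i) (x i) (y i))) (sumFin-+ n _ _)

m*n<m⇒n≡0 : ∀ m n → m ℕ.* n ℕ.< m → n ≡ 0
m*n<m⇒n≡0 m zero    _  = refl
m*n<m⇒n≡0 m (suc n) lt = ⊥-elim (ℕ.<⇒≱ lt (ℕ.m≤m*n m (suc n)))

multiple<modulus⇒≡0 : ∀ b q → ∣ b * q ∣ ℕ.< ∣ b ∣ → q ≡ 0ℤ
multiple<modulus⇒≡0 b q lt =
  ℤ.∣i∣≡0⇒i≡0 (m*n<m⇒n≡0 ∣ b ∣ ∣ q ∣ (subst (ℕ._< ∣ b ∣) (ℤ.abs-* b q) lt))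

digit-cancel : ∀ b {x y r r′} → ∣ x - y ∣ ℕ.< ∣ b ∣ → x + b * r ≡ y + b * r′ → x ≡ y × r ≡ r′
digit-cancel b {x} {y} {r} {r′} close eq =
  ℤ.i-j≡0⇒i≡j x y x-y≡0 , sym (ℤ.i-j≡0⇒i≡j r′ r r′-r≡0)
  where
  b[r′-r]≡x-y : b * (r′ - r) ≡ x - y
  b[r′-r]≡x-y = begin
    b * (r′ - r)                    ≡⟨ solve (b ∷ y ∷ r ∷ r′ ∷ []) ⟩
    ((y + b * r′) - b * r) - y      ≡⟨ cong (λ t → (t - b * r) - y) eq ⟨
    ((x + b * r) - b * r) - y       ≡⟨ solve (b ∷ x ∷ y ∷ r ∷ []) ⟩
    x - y                           ∎
    where open ≡-Reasoning
  r′-r≡0 : r′ - r ≡ 0ℤ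
  r′-r≡0 = multiple<modulus⇒≡0 b (r′ - r)
             (subst (λ t → ∣ t ∣ ℕ.< ∣ b ∣) (sym b[r′-r]≡x-y) close)
  x-y≡0 : x - y ≡ 0ℤ
  x-y≡0 = trans (sym b[r′-r]≡x-y) (trans (cong (b *_) r′-r≡0) (ℤ.*-zeroʳ b))

value-injective : ∀ d n {x y : Fin n → ℤ} → (∀ i → ∣ x i - y i ∣ ℕ.< ∣ base d ∣) →
                  value d n x ≡ value d n y → ∀ i → x i ≡ y i
value-injective d (suc n) {x} {y} close eq
  with digit-cancel (base d) {x zero} {y zero} (close zero)
         (trans (sym (value-suc d n x)) (trans eq (value-suc d n y)))
... | x₀≡y₀ , rest≡ = λ
  { zero    → x₀≡y₀
  ; (suc i) → value-injective d n {x ∘ suc} {y ∘ suc} (close ∘ suc) rest≡ i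
  }

∣digit∣≤ : ∀ {d x} → - (+ d) ℤ.≤ x × x ℤ.≤ + d → ∣ x ∣ ℕ.≤ d
∣digit∣≤ {x = + n}             (_ , +≤+ n≤d) = n≤d
∣digit∣≤ {suc d} {x = -[1+ n ]} (-≤- n≤d , _) = s≤s n≤d

record Midpoint (n : ℕ) (u v w : Fin n → ℤ) : Set where
  constructor midpoint
  field
    at : ∀ i → u i + w i ≡ v i + v i

digitwise-midpoint : ∀ d n {u v w : Fin n → ℤ} → Digits d n u → Digits d n v → Digits d n w →
                     value d n u + value d n w ≡ value d n v + value d n v → Midpoint n u v w
digitwise-midpoint d n {u} {v} {w} du dv dw eq =
  midpoint (value-injective d n close (trans (value-+ d n u w) (trans eq (sym (value-+ d n v v)))))
  where
  close : ∀ i → ∣ (u i + w i) - (v i + v i) ∣ ℕ.< ∣ base d ∣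
  close i = ℕ.≤-<-trans (begin
    ∣ (u i + w i) - (v i + v i) ∣
      ≤⟨ ℤ.∣i-j∣≤∣i∣+∣j∣ (u i + w i) (v i + v i) ⟩
    ∣ u i + w i ∣ ℕ.+ ∣ v i + v i ∣
      ≤⟨ ℕ.+-mono-≤ (ℤ.∣i+j∣≤∣i∣+∣j∣ (u i) (w i)) (ℤ.∣i+j∣≤∣i∣+∣j∣ (v i) (v i)) ⟩
    (∣ u i ∣ ℕ.+ ∣ w i ∣) ℕ.+ (∣ v i ∣ ℕ.+ ∣ v i ∣)
      ≤⟨ ℕ.+-mono-≤ (ℕ.+-mono-≤ (∣digit∣≤ (du i)) (∣digit∣≤ (dw i)))
                    (ℕ.+-mono-≤ (∣digit∣≤ (dv i)) (∣digit∣≤ (dv i))) ⟩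
    (d ℕ.+ d) ℕ.+ (d ℕ.+ d)
      ≡⟨ ℕ-Solver.solve (d ∷ []) ⟩
    4 ℕ.* d
      ∎)
    (ℕ.m<m+n (4 ℕ.* d) ℕ.z<s)
    where open ℕ.≤-Reasoning

normSq : (n : ℕ) → (Fin n → ℤ) → ℕ
normSq zero    x = 0
normSq (suc n) x = ∣ x zero ∣ ℕ.* ∣ x zero ∣ ℕ.+ normSq n (x ∘ suc)

i*i≡∣i∣*∣i∣ : ∀ i → i * i ≡ + (∣ i ∣ ℕ.* ∣ i ∣)
i*i≡∣i∣*∣i∣ (+ n)     = sym (ℤ.pos-* n n)
i*i≡∣i∣*∣i∣ -[1+ n ] = refl

sqSum≡normSq : ∀ n (x : Fin n → ℤ) → sqSum n x ≡ + normSq n x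
sqSum≡normSq zero    x = refl
sqSum≡normSq (suc n) x = cong₂ _+_ (i*i≡∣i∣*∣i∣ (x zero)) (sqSum≡normSq n (x ∘ suc))

normSq≡0⇒≡0 : ∀ n (x : Fin n → ℤ) → normSq n x ≡ 0 → ∀ i → x i ≡ 0ℤ
normSq≡0⇒≡0 (suc n) x eq zero    =
  ℤ.∣i∣≡0⇒i≡0 (reduce (ℕ.m*n≡0⇒m≡0∨n≡0 ∣ x zero ∣ (ℕ.m+n≡0⇒m≡0 _ eq)))
normSq≡0⇒≡0 (suc n) x eq (suc i) = normSq≡0⇒≡0 n (x ∘ suc) (ℕ.m+n≡0⇒n≡0 _ eq) i

-- x vanishes outside j, expressed through its dot products.
SupportedAt : (n : ℕ) → (Fin n → ℤ) → Fin n → Set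
SupportedAt n x j = x j ≢ 0ℤ × (∀ g → dot n g x ≡ g j * x j)

normSq≡1⇒supported : ∀ n (x : Fin n → ℤ) → normSq n x ≡ 1 → Σ[ j ∈ Fin n ] SupportedAt n x j
normSq≡1⇒supported (suc n) x eq = split ∣ x zero ∣ refl
  where
  rest : ℕ
  rest = normSq n (x ∘ suc)
  split : ∀ a → ∣ x zero ∣ ≡ a → Σ[ j ∈ Fin (suc n) ] SupportedAt (suc n) x j
  split zero ∣x₀∣≡0
    with normSq≡1⇒supported n (x ∘ suc) (subst (λ a → a ℕ.* a ℕ.+ rest ≡ 1) ∣x₀∣≡0 eq)
  ... | j , xj≢0 , dot≡ = suc j , xj≢0 , λ g → begin
    g zero * x zero + dot n (g ∘ suc) (x ∘ suc)
      ≡⟨ cong (_+ dot n (g ∘ suc) (x ∘ suc))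
              (trans (cong (g zero *_) (ℤ.∣i∣≡0⇒i≡0 ∣x₀∣≡0)) (ℤ.*-zeroʳ (g zero))) ⟩
    0ℤ + dot n (g ∘ suc) (x ∘ suc)  ≡⟨ ℤ.+-identityˡ _ ⟩
    dot n (g ∘ suc) (x ∘ suc)       ≡⟨ dot≡ (g ∘ suc) ⟩
    g (suc j) * x (suc j)           ∎
    where open ≡-Reasoning
  split (suc k) ∣x₀∣≡1+k = zero , x₀≢0 , λ g →
    trans (cong (_+_ (g zero * x zero)) (dot-zeroʳ n (g ∘ suc) (x ∘ suc) rest≗0))
          (ℤ.+-identityʳ (g zero * x zero))
    where
    x₀≢0 : x zero ≢ 0ℤ
    x₀≢0 x₀≡0 with () ← trans (sym ∣x₀∣≡1+k) (cong ∣_∣ x₀≡0)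
    rest≗0 : ∀ i → x (suc i) ≡ 0ℤ
    rest≗0 = normSq≡0⇒≡0 n (x ∘ suc) (ℕ.m+n≡0⇒n≡0 (k ℕ.+ k ℕ.* suc k)
               (ℕ.suc-injective (subst (λ a → a ℕ.* a ℕ.+ rest ≡ 1) ∣x₀∣≡1+k eq)))

midpoint-other : ∀ u v w → u + w ≡ v + v → w ≡ (v + v) - u
midpoint-other u v w eq = begin
  w               ≡⟨ solve (u ∷ w ∷ []) ⟩
  (u + w) - u     ≡⟨ cong (_- u) eq ⟩
  (v + v) - u     ∎
  where open ≡-Reasoning

parallelogram-law : ∀ u v w → u + w ≡ v + v →
                    u * u + w * w ≡ (v * v + v * v) + ((u - v) * (u - v) + (u - v) * (u - v))
parallelogram-law u v w eq = begin
  u * u + w * w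
    ≡⟨ cong (λ t → u * u + t * t) (midpoint-other u v w eq) ⟩
  u * u + ((v + v) - u) * ((v + v) - u)
    ≡⟨ solve (u ∷ v ∷ []) ⟩
  (v * v + v * v) + ((u - v) * (u - v) + (u - v) * (u - v))
    ∎
  where open ≡-Reasoning

midpoint-square-difference : ∀ u v w → u + w ≡ v + v → u * u ≡ w * w + + 4 * (v * (u - v))
midpoint-square-difference u v w eq = begin
  u * u                                                ≡⟨ solve (u ∷ v ∷ []) ⟩
  ((v + v) - u) * ((v + v) - u) + + 4 * (v * (u - v))
    ≡⟨ cong (λ t → t * t + + 4 * (v * (u - v))) (midpoint-other u v w eq) ⟨
  w * w + + 4 * (v * (u - v))                          ∎
  where open ≡-Reasoning

midpoint-sqSum : ∀ n {u v w : Fin n → ℤ} → Midpoint n u v w →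
                 sqSum n u + sqSum n w ≡
                 (sqSum n v + sqSum n v) + (sqSum n (λ i → u i - v i) + sqSum n (λ i → u i - v i))
midpoint-sqSum n {u} {v} {w} (midpoint mid) = begin
  sqSum n u + sqSum n w                                              ≡⟨ sumFin-+ n _ _ ⟨
  sumFin n (λ i → u i * u i + w i * w i)
    ≡⟨ sumFin-cong n (λ i → parallelogram-law (u i) (v i) (w i) (mid i)) ⟩
  sumFin n (λ i → (v i * v i + v i * v i) + (m i * m i + m i * m i)) ≡⟨ sumFin-+ n _ _ ⟩
  sumFin n (λ i → v i * v i + v i * v i) + sumFin n (λ i → m i * m i + m i * m i)
    ≡⟨ cong₂ _+_ (sumFin-+ n _ _) (sumFin-+ n _ _) ⟩
  (sqSum n v + sqSum n v) + (sqSum n m + sqSum n m)                  ∎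
  where
  open ≡-Reasoning
  m : Fin n → ℤ
  m i = u i - v i

midpoint-sqSum-difference : ∀ n {u v w : Fin n → ℤ} → Midpoint n u v w →
                            sqSum n u ≡ sqSum n w + + 4 * dot n v (λ i → u i - v i)
midpoint-sqSum-difference n {u} {v} {w} (midpoint mid) = begin
  sqSum n u
    ≡⟨ sumFin-cong n (λ i → midpoint-square-difference (u i) (v i) (w i) (mid i)) ⟩
  sumFin n (λ i → w i * w i + + 4 * (v i * (u i - v i)))
    ≡⟨ sumFin-+ n _ _ ⟩
  sqSum n w + sumFin n (λ i → + 4 * (v i * (u i - v i)))
    ≡⟨ cong (_+_ (sqSum n w)) (*-distribˡ-sumFin n (+ 4) _) ⟨
  sqSum n w + + 4 * dot n v (λ i → u i - v i)
    ∎
  where open ≡-Reasoning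

nonneg-sum≡0⇒≡0 : ∀ {i j} → + 0 ℤ.≤ i → + 0 ℤ.≤ j → i + j ≡ 0ℤ → i ≡ 0ℤ
nonneg-sum≡0⇒≡0 (+≤+ _) (+≤+ _) eq = cong +_ (ℕ.m+n≡0⇒m≡0 _ (ℤ.+-injective eq))

nonneg-midpoint-offset≢unit : ∀ n {u v w : Fin n → ℤ} → Nonneg n u → Nonneg n w → Midpoint n u v w →
                              sqSum n u ≡ sqSum n w → normSq n (λ i → u i - v i) ≢ 1
nonneg-midpoint-offset≢unit n {u} {v} {w} u≥0 w≥0 mid same m²≡1 =
  absurd (normSq≡1⇒supported n m m²≡1)
  where
  m : Fin n → ℤ
  m i = u i - v i
  v⊥m : dot n v m ≡ 0ℤ
  v⊥m = ℤ.*-cancelˡ-≡ (+ 4) _ 0ℤ (∙-cancelˡ (sqSum n w) _ _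
          (trans (sym (midpoint-sqSum-difference n mid)) (trans same (sym (ℤ.+-identityʳ (sqSum n w))))))
  absurd : Σ[ j ∈ Fin n ] SupportedAt n m j → ⊥
  absurd (j , mj≢0 , dot≡) = mj≢0 (cong₂ _-_ uj≡0 vj≡0)
    where
    vj≡0 : v j ≡ 0ℤ
    vj≡0 = [ id , ⊥-elim ∘ mj≢0 ]′ (ℤ.i*j≡0⇒i≡0∨j≡0 (v j) (trans (sym (dot≡ v)) v⊥m))
    uj≡0 : u j ≡ 0ℤ
    uj≡0 = nonneg-sum≡0⇒≡0 (u≥0 j) (w≥0 j) (trans (Midpoint.at mid j) (cong₂ _+_ vj≡0 vj≡0))

excess-balance : ∀ s {a b c M} → (s ℕ.+ a) ℕ.+ (s ℕ.+ c) ≡ ((s ℕ.+ b) ℕ.+ (s ℕ.+ b)) ℕ.+ (M ℕ.+ M) →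
                 a ℕ.+ c ≡ 2 ℕ.* (b ℕ.+ M)
excess-balance s {a} {b} {c} {M} eq = ℕ.+-cancelˡ-≡ (s ℕ.+ s) _ _ (begin
  (s ℕ.+ s) ℕ.+ (a ℕ.+ c)                          ≡⟨ ℕ-Solver.solve (s ∷ a ∷ c ∷ []) ⟩
  (s ℕ.+ a) ℕ.+ (s ℕ.+ c)                          ≡⟨ eq ⟩
  ((s ℕ.+ b) ℕ.+ (s ℕ.+ b)) ℕ.+ (M ℕ.+ M)          ≡⟨ ℕ-Solver.solve (s ∷ b ∷ M ∷ []) ⟩
  (s ℕ.+ s) ℕ.+ 2 ℕ.* (b ℕ.+ M)                    ∎)
  where open ≡-Reasoning

excess-cases : ∀ {a c} b M → a ℕ.≤ 1 → c ℕ.≤ 1 → a ℕ.+ c ≡ 2 ℕ.* (b ℕ.+ M) →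
               M ≡ 0 ⊎ (M ≡ 1 × a ≡ 1 × c ≡ 1)
excess-cases b       M z≤n       z≤n       eq = inj₁ (ℕ.m+n≡0⇒n≡0 b (sym (ℕ.*-cancelˡ-≡ 0 _ 2 eq)))
excess-cases b       M z≤n       (s≤s z≤n) eq = ⊥-elim (ℕ.even≢odd (b ℕ.+ M) 0 (sym eq))
excess-cases b       M (s≤s z≤n) z≤n       eq = ⊥-elim (ℕ.even≢odd (b ℕ.+ M) 0 (sym eq))
excess-cases zero    M (s≤s z≤n) (s≤s z≤n) eq = inj₂ (sym (ℕ.*-cancelˡ-≡ 1 M 2 eq) , refl , refl)
excess-cases (suc b) M (s≤s z≤n) (s≤s z≤n) eq =
  inj₁ (ℕ.m+n≡0⇒n≡0 b (sym (ℕ.suc-injective (ℕ.*-cancelˡ-≡ 1 _ 2 eq))))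

padZero : ∀ n → (Fin n → ℤ) → Fin (suc n) → ℤ
padZero zero    x _       = 0ℤ
padZero (suc n) x zero    = x zero
padZero (suc n) x (suc i) = padZero n (x ∘ suc) i

sumFin-padZero : ∀ (F : ℕ → ℤ → ℤ) → (∀ m → F m 0ℤ ≡ 0ℤ) → ∀ n (x : Fin n → ℤ) →
                 sumFin (suc n) (λ i → F (toℕ i) (padZero n x i)) ≡ sumFin n (λ i → F (toℕ i) (x i))
sumFin-padZero F F0 zero    x = trans (ℤ.+-identityʳ (F 0 0ℤ)) (F0 0)
sumFin-padZero F F0 (suc n) x =
  cong (_+_ (F 0 (x zero))) (sumFin-padZero (F ∘ suc) (F0 ∘ suc) n (x ∘ suc))

padZero-Digits : ∀ d n {x} → Digits d n x → Digits d (suc n) (padZero n x)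
padZero-Digits d zero    _  _       = ℤ.neg-≤-pos , +≤+ z≤n
padZero-Digits d (suc n) dx zero    = dx zero
padZero-Digits d (suc n) dx (suc i) = padZero-Digits d n (dx ∘ suc) i

-- Common form of the elements of A_{d,s,k} (padded, excess 0) and of A_{d,s+1,k,C} (excess 1).
record Representation (d s k : ℕ) (t : ℤ) : Set where
  field
    digits   : Fin (suc k) → ℤ
    bounded  : Digits d (suc k) digits
    value≡   : value d (suc k) digits ≡ t
    excess   : ℕ
    excess≤1 : excess ℕ.≤ 1
    sqSum≡   : sqSum (suc k) digits ≡ + (s ℕ.+ excess)
    nonneg   : excess ≡ 1 → Nonneg (suc k) digits

open Representation

fromUnion : ∀ {d s k t} → (A d s k ∪ AC d (suc s) k (Nonneg (suc k))) t → Representation d s k t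
fromUnion {d} {s} {k} (inj₁ (x , dx , sq , val)) = record
  { digits   = padZero k x
  ; bounded  = padZero-Digits d k dx
  ; value≡   = trans (sumFin-padZero (λ m a → a * base d ^ m) (λ m → ℤ.*-zeroˡ (base d ^ m)) k x) val
  ; excess   = 0
  ; excess≤1 = z≤n
  ; sqSum≡   = trans (sumFin-padZero (λ _ a → a * a) (λ _ → refl) k x)
                     (trans sq (cong +_ (sym (ℕ.+-identityʳ s))))
  ; nonneg   = λ ()
  }
fromUnion {s = s} (inj₂ (x , dx , sq , x≥0 , val)) = record
  { digits   = x
  ; bounded  = dx
  ; value≡   = val
  ; excess   = 1
  ; excess≤1 = ℕ.≤-refl
  ; sqSum≡   = trans sq (cong +_ (ℕ.+-comm 1 s))
  ; nonneg   = λ _ → x≥0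
  }

AP⇒digitwise-midpoint : ∀ {d s k x y z} (X : Representation d s k x) (Y : Representation d s k y)
                        (Z : Representation d s k z) → x + z ≡ + 2 * y →
                        Midpoint (suc k) (digits X) (digits Y) (digits Z)
AP⇒digitwise-midpoint {d} {k = k} {x} {y} {z} X Y Z x+z≡2y =
  digitwise-midpoint d (suc k) (bounded X) (bounded Y) (bounded Z) (begin
    value d (suc k) (digits X) + value d (suc k) (digits Z)  ≡⟨ cong₂ _+_ (value≡ X) (value≡ Z) ⟩
    x + z                                                    ≡⟨ x+z≡2y ⟩
    + 2 * y                                                  ≡⟨ solve (y ∷ []) ⟩
    y + y                                                    ≡⟨ cong₂ _+_ (value≡ Y) (value≡ Y) ⟨
    value d (suc k) (digits Y) + value d (suc k) (digits Y)  ∎)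
  where open ≡-Reasoning

midpoint-excess-balance : ∀ {d s k x y z} (X : Representation d s k x) (Y : Representation d s k y)
                          (Z : Representation d s k z) →
                          Midpoint (suc k) (digits X) (digits Y) (digits Z) →
                          excess X ℕ.+ excess Z ≡
                          2 ℕ.* (excess Y ℕ.+ normSq (suc k) (λ i → digits X i - digits Y i))
midpoint-excess-balance {s = s} {k} X Y Z mid = excess-balance s (ℤ.+-injective (begin
  + (s ℕ.+ excess X) + + (s ℕ.+ excess Z)            ≡⟨ cong₂ _+_ (sqSum≡ X) (sqSum≡ Z) ⟨
  sqSum n (digits X) + sqSum n (digits Z)            ≡⟨ midpoint-sqSum n mid ⟩
  (sqSum n (digits Y) + sqSum n (digits Y)) + (sqSum n m + sqSum n m)
    ≡⟨ cong₂ _+_ (cong₂ _+_ (sqSum≡ Y) (sqSum≡ Y)) (cong₂ _+_ (sqSum≡normSq n m) (sqSum≡normSq n m)) ⟩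
  (+ (s ℕ.+ excess Y) + + (s ℕ.+ excess Y)) + (+ normSq n m + + normSq n m) ∎))
  where
  open ≡-Reasoning
  n = suc k
  m : Fin n → ℤ
  m i = digits X i - digits Y i

representation-AP-trivial : ∀ {d s k x y z} → Representation d s k x → Representation d s k y →
                            Representation d s k z → x + z ≡ + 2 * y → x ≡ y
representation-AP-trivial {d} {s} {k} {x} {y} {z} X Y Z x+z≡2y =
  [ x≡y , ⊥-elim ∘ impossible ]′
    (excess-cases (excess Y) M (excess≤1 X) (excess≤1 Z) (midpoint-excess-balance X Y Z mid))
  where
  n = suc k
  u = digits X
  v = digits Y
  w = digits Z
  m : Fin n → ℤ
  m i = u i - v i
  M = normSq n m
  mid : Midpoint n u v w
  mid = AP⇒digitwise-midpoint X Y Z x+z≡2y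
  x≡y : M ≡ 0 → x ≡ y
  x≡y M≡0 = trans (sym (value≡ X)) (trans (sumFin-cong n u≡v) (value≡ Y))
    where
    u≡v : ∀ i → u i * base d ^ toℕ i ≡ v i * base d ^ toℕ i
    u≡v i = cong (_* base d ^ toℕ i) (ℤ.i-j≡0⇒i≡j (u i) (v i) (normSq≡0⇒≡0 n m M≡0 i))
  impossible : M ≡ 1 × excess X ≡ 1 × excess Z ≡ 1 → ⊥
  impossible (M≡1 , a≡1 , c≡1) =
    nonneg-midpoint-offset≢unit n (nonneg X a≡1) (nonneg Z c≡1) mid equal-norms M≡1
    where
    equal-norms : sqSum n u ≡ sqSum n w
    equal-norms = begin
      sqSum n u               ≡⟨ sqSum≡ X ⟩
      + (s ℕ.+ excess X)      ≡⟨ cong (λ e → + (s ℕ.+ e)) (trans a≡1 (sym c≡1)) ⟩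
      + (s ℕ.+ excess Z)      ≡⟨ sqSum≡ Z ⟨
      sqSum n w               ∎
      where open ≡-Reasoning

mainTheorem6 : (d k s : ℕ) → ThreeFree (A d s k ∪ AC d (suc s) k (Nonneg (suc k)))
mainTheorem6 d k s x y z x∈ y∈ z∈ x<y _ x+z≡2y =
  ℤ.<-irrefl (representation-AP-trivial (fromUnion x∈) (fromUnion y∈) (fromUnion z∈) x+z≡2y) x<y
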